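{- For all integers $\Delta> d\geq 1$, $$\chi_\star(\mathcal{D}_\Delta) \leq \left(\left\lfloor\frac{\Delta}{d+1}\right\rfloor+1\right) \chi_\star(\mathcal{D}_d).$$
   Context: $\mathcal{D}_\Delta$ denotes the class of graphs with maximum degree at most $\Delta$. A $k$-colouring assigns one of $k$ colours to each vertex (not necessarily properly); a monochromatic component is a connected component of the subgraph induced by one colour; a colouring has clustering $c$ if every monochromatic component has at most $c$ vertices. The clustered chromatic number $\chi_\star(\mathcal{G})$ of a class $\mathcal{G}$ is the minimum integer $k$ for which there exists an integer $c$ such that every graph in $\mathcal{G}$ has a $k$-colouring with clustering $c$. -}

module Defs where

open import Data.Nat using (ℕ; suc; _≤_; _<_)
open import Data.Bool using (Bool; T; true; false)
open import Data.Fin using (Fin)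
open import Data.List using (List; length; filter)
open import Data.Fin.Base using ()
open import Data.List.Base using ()
open import Data.Product using (Σ; _×_; ∃)
open import Relation.Nullary using (¬_)
open import Relation.Binary.PropositionalEquality using (_≡_)
open import Relation.Binary.Construct.Closure.ReflexiveTransitive using (Star)
open import Function.Definitions using (Injective)
open import Data.Bool.Properties using (T?)
import Data.Fin as Fin
import Data.List as List

record Graph (n : ℕ) : Set where
  field
    adj   : Fin n → Fin n → Bool
    sym   : ∀ u v → adj u v ≡ adj v u
    irrefl : ∀ v → adj v v ≡ false
open Graph public

degree : ∀ {n} → Graph n → Fin n → ℕ
degree G v = length (filter (λ u → T? (adj G v u)) (List.allFin _))

MaxDegreeAtMost : ∀ {n} → Graph n → ℕ → Set
MaxDegreeAtMost G Δ = ∀ v → degree G v ≤ Δ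

-- a (not necessarily proper) k-colouring
Colouring : ℕ → ℕ → Set
Colouring n k = Fin n → Fin k

MonoEdge : ∀ {n k} → Graph n → Colouring n k → Fin n → Fin n → Set
MonoEdge G col u w = T (adj G u w) × col u ≡ col w

MonoConnected : ∀ {n k} → Graph n → Colouring n k → Fin n → Fin n → Set
MonoConnected G col = Star (MonoEdge G col)

-- every monochromatic component has at most c vertices: there is no
-- injection of c+1 vertices into the monochromatic component of any vertex v
HasClustering : ∀ {n k} → Graph n → Colouring n k → ℕ → Set
HasClustering {n} G col c =
  ∀ (v : Fin n) (f : Fin (suc c) → Fin n) →
    Injective _≡_ _≡_ f → ¬ (∀ i → MonoConnected G col v (f i))

ClusteredColourable : ℕ → ℕ → Set
ClusteredColourable Δ k =
  Σ ℕ λ c → ∀ n (G : Graph n) → MaxDegreeAtMost G Δ →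
    Σ (Colouring n k) λ col → HasClustering G col c

IsClusteredChromaticNumber : ℕ → ℕ → Set
IsClusteredChromaticNumber Δ k =
  ClusteredColourable Δ k × (∀ j → j < k → ¬ ClusteredColourable Δ j)

module Submission where

-- Let t = ⌊Δ/(d+1)⌋ + 1, so that Δ < t·(d+1).  Every graph G of
-- maximum degree at most Δ has a partition p : V → Fin t in which every vertex
-- has at most d neighbours in its own part (Lovász): while some vertex v has
-- more than d neighbours in its own part, move v to a part containing at most
-- d of its neighbours -- one exists by pigeonhole, as deg v ≤ Δ < t·(d+1).
-- Such a move strictly decreases the number of ordered pairs of adjacent
-- vertices lying in a common part, so the process terminates.  The edges
-- inside the parts form a graph of maximum degree at most d; colour it with
-- χ⋆(𝒟_d) colours and clustering c, and pair each colour with the part of the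
-- vertex.  A monochromatic edge of this product colouring is a monochromatic
-- edge of the internal graph, so the clustering is still c, and G is
-- t·χ⋆(𝒟_d)-colourable with clustering c.  Minimality of χ⋆(𝒟_Δ) finishes.

open import Defs hiding (sym)
open import Data.Nat using (ℕ; zero; suc; _+_; _*_; _≤_; _<_; _/_; _%_; z≤n; _≤?_; _<?_)
open import Data.Nat.Properties
open import Data.Nat.DivMod using (m≡m%n+[m/n]*n; m%n<n)
open import Data.Nat.Induction using (<-wellFounded)
open import Induction.WellFounded using (Acc; acc)
open import Data.Bool using (Bool; true; false; _∧_)
open import Data.Bool.Properties using (T?; T-∧; T-≡; ∧-zeroʳ; ∧-identityʳ)
open import Function.Bundles using (Equivalence)
open import Data.Fin using (Fin; punchIn; combine) renaming (_≟_ to _≟ᶠ_)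
import Data.Fin as Fin
open import Data.Fin.Properties using (any?; punchInᵢ≢i; combine-injective)
open import Data.Vec.Functional using (updateAt)
open import Data.Vec.Functional.Properties using (updateAt-updates; updateAt-minimal)
open import Data.List using (length; filter; tabulate)
open import Data.Product using (Σ; _,_; proj₁; proj₂)
open import Function using (_∘_; const)
open import Relation.Nullary using (yes; no; does; contradiction)
open import Relation.Nullary.Decidable using (dec-true; dec-false)
open import Relation.Binary.PropositionalEquality
  using (_≡_; _≢_; refl; sym; trans; cong; cong₂; subst; module ≡-Reasoning)
open import Relation.Binary.Construct.Closure.ReflexiveTransitive using (map)
open import Algebra.Properties.CommutativeMonoid.Sum +-0-commutativeMonoid
  using (sum; sum-syntax; sum-cong-≗; sum-remove; sum-replicate-zero; ∑-distrib-+; ∑-comm)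

∑-const : ∀ n k → ∑[ i < n ] k ≡ n * k
∑-const zero    k = refl
∑-const (suc n) k = cong (k +_) (∑-const n k)

∑-mono-≤ : ∀ {n} {f g : Fin n → ℕ} → (∀ i → f i ≤ g i) → sum f ≤ sum g
∑-mono-≤ {zero}  f≤g = z≤n
∑-mono-≤ {suc n} f≤g = +-mono-≤ (f≤g Fin.zero) (∑-mono-≤ (f≤g ∘ Fin.suc))

∑-single : ∀ {n} (f : Fin n → ℕ) (i : Fin n) → (∀ j → j ≢ i → f j ≡ 0) → sum f ≡ f i
∑-single {suc n} f i vanish = begin
  sum f                            ≡⟨ sum-remove {i = i} f ⟩
  f i + ∑[ j < n ] f (punchIn i j) ≡⟨ cong (f i +_) rest≡0 ⟩
  f i + 0                          ≡⟨ +-identityʳ (f i) ⟩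
  f i                              ∎
  where
  open ≡-Reasoning
  rest≡0 : ∑[ j < n ] f (punchIn i j) ≡ 0
  rest≡0 = trans (sum-cong-≗ (λ j → vanish (punchIn i j) (punchInᵢ≢i i j)))
                 (sum-replicate-zero n)

pigeonhole : ∀ {t} d (f : Fin t → ℕ) → sum f < t * suc d → Σ (Fin t) λ i → f i ≤ d
pigeonhole {t} d f small with any? (λ i → f i ≤? d)
... | yes found = found
... | no none   = contradiction small (≤⇒≯ (begin
  t * suc d        ≡⟨ sym (∑-const t (suc d)) ⟩
  ∑[ i < t ] suc d ≤⟨ ∑-mono-≤ (λ i → ≰⇒> (λ fi≤d → none (i , fi≤d))) ⟩
  sum f            ∎))
  where open ≤-Reasoning

∑∑-avoiding : ∀ {m} → Fin (suc m) → (Fin (suc m) → Fin (suc m) → ℕ) → ℕ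
∑∑-avoiding {m} v f = ∑[ x < m ] ∑[ y < m ] f (punchIn v x) (punchIn v y)

∑∑-split : ∀ {m} (v : Fin (suc m)) (f : Fin (suc m) → Fin (suc m) → ℕ) →
  (∀ x → f x v ≡ f v x) → f v v ≡ 0 →
  ∑[ x < suc m ] ∑[ y < suc m ] f x y ≡ ∑∑-avoiding v f + (sum (f v) + sum (f v))
∑∑-split {m} v f symm diag = begin
  ∑[ x < suc m ] ∑[ y < suc m ] f x y
    ≡⟨ sum-remove {i = v} (λ x → sum (f x)) ⟩
  row + ∑[ x < m ] sum (f (punchIn v x))
    ≡⟨ cong (row +_) (sum-cong-≗ (λ x → sum-remove {i = v} (f (punchIn v x)))) ⟩
  row + ∑[ x < m ] (f (punchIn v x) v + ∑[ y < m ] f (punchIn v x) (punchIn v y))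
    ≡⟨ cong (row +_) (∑-distrib-+ (λ x → f (punchIn v x) v) _) ⟩
  row + (column + ∑∑-avoiding v f)
    ≡⟨ cong (λ c → row + (c + ∑∑-avoiding v f)) column≡row ⟩
  row + (row + ∑∑-avoiding v f)
    ≡⟨ sym (+-assoc row row _) ⟩
  (row + row) + ∑∑-avoiding v f
    ≡⟨ +-comm (row + row) _ ⟩
  ∑∑-avoiding v f + (row + row) ∎
  where
  open ≡-Reasoning
  row    = sum (f v)
  column = ∑[ x < m ] f (punchIn v x) v
  column≡row : column ≡ row
  column≡row = begin
    column                 ≡⟨ cong (_+ column) diag ⟨
    f v v + column         ≡⟨ sum-remove {i = v} (λ x → f x v) ⟨
    ∑[ x < suc m ] f x v   ≡⟨ sum-cong-≗ symm ⟩
    row                    ∎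

∑∑-local-decrease : ∀ {n} (v : Fin n) (f g : Fin n → Fin n → ℕ) →
  (∀ x → f x v ≡ f v x) → f v v ≡ 0 →
  (∀ x → g x v ≡ g v x) → g v v ≡ 0 →
  (∀ x y → x ≢ v → y ≢ v → g x y ≡ f x y) →
  sum (g v) < sum (f v) →
  ∑[ x < n ] ∑[ y < n ] g x y < ∑[ x < n ] ∑[ y < n ] f x y
∑∑-local-decrease {suc m} v f g symmᶠ diagᶠ symmᵍ diagᵍ agree smaller = begin-strict
  ∑[ x < suc m ] ∑[ y < suc m ] g x y     ≡⟨ ∑∑-split v g symmᵍ diagᵍ ⟩
  ∑∑-avoiding v g + (sum (g v) + sum (g v)) ≡⟨ cong (_+ (sum (g v) + sum (g v))) same-avoiding ⟩
  ∑∑-avoiding v f + (sum (g v) + sum (g v)) <⟨ +-monoʳ-< (∑∑-avoiding v f) (+-mono-< smaller smaller) ⟩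
  ∑∑-avoiding v f + (sum (f v) + sum (f v)) ≡⟨ ∑∑-split v f symmᶠ diagᶠ ⟨
  ∑[ x < suc m ] ∑[ y < suc m ] f x y     ∎
  where
  open ≤-Reasoning
  same-avoiding : ∑∑-avoiding v g ≡ ∑∑-avoiding v f
  same-avoiding = sum-cong-≗ (λ x → sum-cong-≗ (λ y →
    agree (punchIn v x) (punchIn v y) (punchInᵢ≢i v x) (punchInᵢ≢i v y)))

𝟙 : Bool → ℕ
𝟙 true  = 1
𝟙 false = 0

length-filter-tabulate : ∀ {A : Set} n (f : Fin n → A) (b : A → Bool) →
  length (filter (T? ∘ b) (tabulate f)) ≡ ∑[ i < n ] 𝟙 (b (f i))
length-filter-tabulate zero    f b = refl
length-filter-tabulate (suc n) f b with b (f Fin.zero)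
... | true  = cong suc (length-filter-tabulate n (f ∘ Fin.suc) b)
... | false = length-filter-tabulate n (f ∘ Fin.suc) b

degree-as-sum : ∀ {n} (G : Graph n) v → degree G v ≡ ∑[ u < n ] 𝟙 (adj G v u)
degree-as-sum {n} G v = length-filter-tabulate n (λ u → u) (adj G v)

does-≟-sym : ∀ {t} (a b : Fin t) → does (a ≟ᶠ b) ≡ does (b ≟ᶠ a)
does-≟-sym a b with a ≟ᶠ b
... | yes a≡b = sym (dec-true (b ≟ᶠ a) (sym a≡b))
... | no a≢b  = sym (dec-false (b ≟ᶠ a) (a≢b ∘ sym))

module Partitions {n} (G : Graph n) (t : ℕ) where

  Partition : Set
  Partition = Fin n → Fin t

  internalEdge : Partition → Fin n → Fin n → Bool
  internalEdge p x y = adj G x y ∧ does (p x ≟ᶠ p y)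

  internalDegree : Partition → Fin n → ℕ
  internalDegree p v = ∑[ u < n ] 𝟙 (internalEdge p v u)

  neighboursIn : Partition → Fin n → Fin t → ℕ
  neighboursIn p v b = ∑[ u < n ] 𝟙 (adj G v u ∧ does (b ≟ᶠ p u))

  internalPairs : Partition → ℕ
  internalPairs p = ∑[ x < n ] ∑[ y < n ] 𝟙 (internalEdge p x y)

  move : Partition → Fin n → Fin t → Partition
  move p v b = updateAt p v (const b)

  internalEdge-sym : ∀ p x y → internalEdge p x y ≡ internalEdge p y x
  internalEdge-sym p x y = cong₂ _∧_ (Graph.sym G x y) (does-≟-sym (p x) (p y))

  internalEdge-irrefl : ∀ p v → internalEdge p v v ≡ false
  internalEdge-irrefl p v = cong (_∧ does (p v ≟ᶠ p v)) (irrefl G v)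

  internalGraph : Partition → Graph n
  internalGraph p = record
    { adj    = internalEdge p
    ; sym    = internalEdge-sym p
    ; irrefl = internalEdge-irrefl p
    }

  internalGraph-degree : ∀ p v → degree (internalGraph p) v ≡ internalDegree p v
  internalGraph-degree p v = degree-as-sum (internalGraph p) v

  -- Each neighbour of v lies in exactly one part.
  ∑-neighboursIn : ∀ p v → ∑[ b < t ] neighboursIn p v b ≡ degree G v
  ∑-neighboursIn p v = begin
    ∑[ b < t ] ∑[ u < n ] 𝟙 (adj G v u ∧ does (b ≟ᶠ p u))
      ≡⟨ ∑-comm (λ b u → 𝟙 (adj G v u ∧ does (b ≟ᶠ p u))) ⟩
    ∑[ u < n ] ∑[ b < t ] 𝟙 (adj G v u ∧ does (b ≟ᶠ p u))
      ≡⟨ sum-cong-≗ onePart ⟩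
    ∑[ u < n ] 𝟙 (adj G v u)
      ≡⟨ degree-as-sum G v ⟨
    degree G v ∎
    where
    open ≡-Reasoning
    onePart : ∀ u → ∑[ b < t ] 𝟙 (adj G v u ∧ does (b ≟ᶠ p u)) ≡ 𝟙 (adj G v u)
    onePart u = begin
      ∑[ b < t ] 𝟙 (adj G v u ∧ does (b ≟ᶠ p u))
        ≡⟨ ∑-single _ (p u) (λ b b≢pu →
             cong 𝟙 (trans (cong (adj G v u ∧_) (dec-false (b ≟ᶠ p u) b≢pu)) (∧-zeroʳ _))) ⟩
      𝟙 (adj G v u ∧ does (p u ≟ᶠ p u))
        ≡⟨ cong 𝟙 (trans (cong (adj G v u ∧_) (dec-true (p u ≟ᶠ p u) refl)) (∧-identityʳ _)) ⟩
      𝟙 (adj G v u) ∎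

  internalDegree-move : ∀ p v b → internalDegree (move p v b) v ≡ neighboursIn p v b
  internalDegree-move p v b = sum-cong-≗ pointwise
    where
    pointwise : ∀ u → 𝟙 (internalEdge (move p v b) v u) ≡ 𝟙 (adj G v u ∧ does (b ≟ᶠ p u))
    pointwise u with u ≟ᶠ v
    ... | yes refl = cong 𝟙 (trans (cong (_∧ _) (irrefl G u)) (sym (cong (_∧ _) (irrefl G u))))
    ... | no u≢v   = cong₂ (λ a c → 𝟙 (adj G v u ∧ does (a ≟ᶠ c)))
                       (updateAt-updates v p) (updateAt-minimal u v p u≢v)

  internalEdge-move : ∀ p v b x y → x ≢ v → y ≢ v →
    internalEdge (move p v b) x y ≡ internalEdge p x y
  internalEdge-move p v b x y x≢v y≢v = cong₂ (λ a c → adj G x y ∧ does (a ≟ᶠ c))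
    (updateAt-minimal x v p x≢v) (updateAt-minimal y v p y≢v)

  internalPairs-move : ∀ p v b → neighboursIn p v b < internalDegree p v →
    internalPairs (move p v b) < internalPairs p
  internalPairs-move p v b fewer = ∑∑-local-decrease v
    (λ x y → 𝟙 (internalEdge p x y)) (λ x y → 𝟙 (internalEdge (move p v b) x y))
    (λ x → cong 𝟙 (internalEdge-sym p x v)) (cong 𝟙 (internalEdge-irrefl p v))
    (λ x → cong 𝟙 (internalEdge-sym (move p v b) x v))
    (cong 𝟙 (internalEdge-irrefl (move p v b) v))
    (λ x y x≢v y≢v → cong 𝟙 (internalEdge-move p v b x y x≢v y≢v))
    (subst (_< internalDegree p v) (sym (internalDegree-move p v b)) fewer)

  productColouring-monoEdge : ∀ p {k} (col : Colouring n k) {u w} →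
    MonoEdge G (λ x → combine (p x) (col x)) u w → MonoEdge (internalGraph p) col u w
  productColouring-monoEdge p col {u} {w} (adjacent , sameProduct)
    with combine-injective (p u) (col u) (p w) (col w) sameProduct
  ... | samePart , sameColour =
    Equivalence.from T-∧ (adjacent , Equivalence.from T-≡ (dec-true (p u ≟ᶠ p w) samePart)) ,
    sameColour

  module _ (d : ℕ) (lowDegree : ∀ v → degree G v < t * suc d) where

    sparsePart : ∀ p v → Σ (Fin t) λ b → neighboursIn p v b ≤ d
    sparsePart p v = pigeonhole d (neighboursIn p v)
      (subst (_< t * suc d) (sym (∑-neighboursIn p v)) (lowDegree v))

    -- local search; it terminates since every move decreases internalPairs
    improve : ∀ p → Acc _<_ (internalPairs p) →
      Σ Partition λ q → ∀ v → internalDegree q v ≤ d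
    improve p (acc smaller) with any? (λ v → d <? internalDegree p v)
    ... | no allSparse  = p , λ v → ≮⇒≥ (λ dense → allSparse (v , dense))
    ... | yes (v , dense) with sparsePart p v
    ...   | b , sparse =
      improve (move p v b) (smaller (internalPairs-move p v b (≤-<-trans sparse dense)))

    sparsePartition : Fin t → Σ Partition λ q → ∀ v → internalDegree q v ≤ d
    sparsePartition b₀ = improve (const b₀) (<-wellFounded _)

-- If every monochromatic edge of (G , col) is one of (H , col′), then every
-- monochromatic component of the former lies in one of the latter, so the
-- clustering of (H , col′) bounds that of (G , col).
clustering-transfer : ∀ {n k k′} (G H : Graph n) (col : Colouring n k)
  (col′ : Colouring n k′) c →
  (∀ {u w} → MonoEdge G col u w → MonoEdge H col′ u w) →
  HasClustering H col′ c → HasClustering G col c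
clustering-transfer G H col col′ c monoEdge clustered v f f-injective connected =
  clustered v f f-injective (λ i → map monoEdge (connected i))

-- A bound Δ < t·(d+1) forces t ≥ 1, giving a part to start from.
firstPart : ∀ {t Δ} d → Δ < t * suc d → Fin t
firstPart {suc t} d _ = Fin.zero

colourable-product : ∀ Δ d t k → Δ < t * suc d →
  ClusteredColourable d k → ClusteredColourable Δ (t * k)
colourable-product Δ d t k bound (c , colourSparse) = c , colour
  where
  colour : ∀ n (G : Graph n) → MaxDegreeAtMost G Δ →
    Σ (Colouring n (t * k)) λ col → HasClustering G col c
  colour n G maxDegree =
    (λ x → combine (p x) (col x)) ,
    clustering-transfer G (internalGraph p) _ col c
      (productColouring-monoEdge p col) (proj₂ colouredInternal)
    where
    open Partitions G t
    partition : Σ Partition λ q → ∀ v → internalDegree q v ≤ d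
    partition = sparsePartition d (λ v → ≤-<-trans (maxDegree v) bound) (firstPart d bound)
    p : Partition
    p = proj₁ partition
    internalSparse : MaxDegreeAtMost (internalGraph p) d
    internalSparse v = subst (_≤ d) (sym (internalGraph-degree p v)) (proj₂ partition v)
    colouredInternal : Σ (Colouring n k) λ col → HasClustering (internalGraph p) col c
    colouredInternal = colourSparse n (internalGraph p) internalSparse
    col : Colouring n k
    col = proj₁ colouredInternal

below-next-multiple : ∀ Δ d → Δ < (Δ / suc d + 1) * suc d
below-next-multiple Δ d = begin-strict
  Δ                           ≡⟨ m≡m%n+[m/n]*n Δ (suc d) ⟩
  Δ % suc d + Δ / suc d * suc d <⟨ +-monoˡ-< (Δ / suc d * suc d) (m%n<n Δ (suc d)) ⟩
  suc d + Δ / suc d * suc d   ≡⟨ cong (_* suc d) (+-comm 1 (Δ / suc d)) ⟩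
  (Δ / suc d + 1) * suc d     ∎
  where open ≤-Reasoning

chromatic-minimal : ∀ {Δ k j} → IsClusteredChromaticNumber Δ k →
  ClusteredColourable Δ j → k ≤ j
chromatic-minimal (_ , minimal) colourable = ≮⇒≥ (λ j<k → minimal _ j<k colourable)

-- The theorem.
mainTheorem7 : ∀ (Δ d : ℕ) → 1 ≤ d → d < Δ →
    ∀ (kΔ kd : ℕ) → IsClusteredChromaticNumber Δ kΔ → IsClusteredChromaticNumber d kd →
      kΔ ≤ (Δ / suc d + 1) * kd
mainTheorem7 Δ d _ _ kΔ kd χΔ (colourable-d , _) = chromatic-minimal χΔ
  (colourable-product Δ d (Δ / suc d + 1) kd (below-next-multiple Δ d) colourable-d)
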